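{- Let $n,k,t\ge 1$ be integers with $2k-t\le n<\frac52(k-t)$. Then every inflation $G$ of $K(n,k,\ge t+1)$ that is connected and has $\alpha(G)=2$ has a non-empty connected dominating matching.
   Context: $K(n,k,\ge s)$ is the graph whose vertices are the $k$-element subsets of $\{1,\dots,n\}$, two distinct subsets being adjacent iff they share at least $s$ elements. An inflation of a graph $H$ is obtained by choosing integers $c_x\ge 0$ for $x\in V(H)$, replacing each $x$ by a clique $C_x$ of order $c_x$, with every vertex of $C_x$ adjacent to every vertex of $C_y$ ($x\neq y$) if $xy\in E(H)$ and no edges between them otherwise. A matching $M$ is connected if for any two edges $e,f\in M$ some endpoint of $e$ is adjacent to some endpoint of $f$; it is dominating if every vertex not covered by $M$ is adjacent to at least one endpoint of each edge of $M$. -}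

module Defs where

open import Data.Nat using (ℕ; suc; _≤_)
open import Data.Fin using (Fin)
open import Data.Fin.Subset using (Subset; _∩_; ∣_∣)
open import Data.List using (List; []; _∷_; length; concatMap)
open import Data.List.Membership.Propositional using (_∈_)
open import Data.List.Relation.Unary.All using (All)
open import Data.List.Relation.Unary.Unique.Propositional using (Unique)
open import Data.Product using (Σ; Σ-syntax; ∃; ∃-syntax; _×_; _,_; proj₁; proj₂)
open import Data.Sum using (_⊎_)
open import Relation.Nullary using (¬_)
open import Relation.Binary.PropositionalEquality using (_≡_; _≢_)
open import Relation.Binary.Construct.Closure.ReflexiveTransitive using (Star)

module _ {V : Set} (Adj : V → V → Set) where

  Independent : List V → Set
  Independent S = Unique S × (∀ {u v} → u ∈ S → v ∈ S → ¬ Adj u v)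

  IndependenceNumber : ℕ → Set
  IndependenceNumber m =
    (Σ[ S ∈ List V ] (Independent S × length S ≡ m))
    × (∀ S → Independent S → length S ≤ m)

  Connected : Set
  Connected = ∀ u v → Star Adj u v

  endpoints : List (V × V) → List V
  endpoints = concatMap (λ e → proj₁ e ∷ proj₂ e ∷ [])

  IsMatching : List (V × V) → Set
  IsMatching M = All (λ e → Adj (proj₁ e) (proj₂ e)) M × Unique (endpoints M)

  EdgesTouch : V × V → V × V → Set
  EdgesTouch (a , b) (c , d) =
    (Adj a c ⊎ Adj a d) ⊎ (Adj b c ⊎ Adj b d)

  IsConnectedMatching : List (V × V) → Set
  IsConnectedMatching M =
    IsMatching M × (∀ {e f} → e ∈ M → f ∈ M → EdgesTouch e f)

  IsDominatingMatching : List (V × V) → Set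
  IsDominatingMatching M =
    IsMatching M ×
    (∀ v → ¬ (v ∈ endpoints M) → ∀ {e} → e ∈ M → Adj v (proj₁ e) ⊎ Adj v (proj₂ e))

  HasNonemptyConnectedDominatingMatching : Set
  HasNonemptyConnectedDominatingMatching =
    Σ[ M ∈ List (V × V) ]
      (M ≢ [] × IsConnectedMatching M × IsDominatingMatching M)

-- vertices: k-element subsets of {1..n} (here Fin n)
KVertex : ℕ → ℕ → Set
KVertex n k = Σ[ A ∈ Subset n ] ∣ A ∣ ≡ k

KAdj : (n k s : ℕ) → KVertex n k → KVertex n k → Set
KAdj n k s (A , _) (B , _) = A ≢ B × s ≤ ∣ A ∩ B ∣

-- Inflations: vertex x of H is replaced by a clique of order c x.

module _ {VH : Set} (AdjH : VH → VH → Set) (c : VH → ℕ) where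

  InflVertex : Set
  InflVertex = Σ[ x ∈ VH ] Fin (c x)

  InflAdj : InflVertex → InflVertex → Set
  InflAdj p q = p ≢ q × (proj₁ p ≡ proj₁ q ⊎ AdjH (proj₁ p) (proj₁ q))

{-# OPTIONS --safe #-}
-- Call distinct non-adjacent vertices far. Two k-sets are far in K(n,k,≥t+1) iff they share at
-- most t points, and counting each point of {1..n} along a closed walk of length 5 gives
-- 5k ≤ 2n + 5t, which 2n < 5(k − t) forbids. Far vertices of an inflation lie over far vertices
-- of H, so in G the far relation has no closed 5-walk either, in particular no triangle.
-- An edge of G with no common far vertex dominates G and is the required matching. Otherwise,
-- for a far pair x, y every vertex is far from x or from y (else a closed 5-walk), and being
-- far from y passes along edges (else a triangle), so a path from x to y makes y far from itself.
-- Only α(G) ≥ 2 and the upper bound on n are used.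
module Submission where

open import Defs
open import Data.Bool using (Bool; true; false; _∧_)
import Data.Bool.Properties as Bool
open import Data.Empty using (⊥; ⊥-elim)
import Data.Fin.Properties as Fin
open import Data.Fin.Subset using (Subset; _∩_; ∣_∣)
open import Data.Fin.Subset.Properties using (∩-comm; anySubset?)
open import Data.List using ([]; _∷_)
open import Data.List.Relation.Unary.All using ([]; _∷_)
open import Data.List.Relation.Unary.AllPairs using ([]; _∷_)
open import Data.List.Relation.Unary.Any using (here; there)
open import Data.List.Membership.Propositional using (_∈_)
open import Data.Nat using (ℕ; suc; _+_; _*_; _∸_; _≤_; _<_; z≤n; s≤s; _≤?_; _≟_)
open import Data.Nat.Properties
  using (≡-irrelevant; +-mono-≤; +-monoʳ-≤; +-monoˡ-<; <⇒≱; ≮⇒≥; n≮0; ≤-total; m≤n⇒m∸n≡0; m∸n+n≡m; module ≤-Reasoning)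
open import Data.Nat.Tactic.RingSolver using (solve-∀)
open import Data.Product using (Σ; ∃; ∃₂; ∃-syntax; _×_; _,_; proj₁; proj₂)
import Data.Product.Properties as Σ
open import Data.Sum using (_⊎_; inj₁; inj₂)
open import Data.Vec using ([]; _∷_)
import Data.Vec.Properties as Vec
open import Function using (_∘_)
open import Level using (0ℓ)
open import Relation.Binary.Core using (Rel)
open import Relation.Binary.Definitions using (Decidable; DecidableEquality; Symmetric; Irreflexive)
open import Relation.Binary.Construct.Closure.ReflexiveTransitive using (Star; ε; _◅_)
open import Relation.Binary.PropositionalEquality using (_≡_; _≢_; refl; sym; cong; cong₂; subst)
open import Relation.Nullary using (¬_; Dec; yes; no; Irrelevant)
open import Relation.Nullary.Decidable using (toWitness; map′; ¬?; _×-dec_; _⊎-dec_; decidable-stable)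

sizeSum : ∀ {n} (a₁ a₂ a₃ a₄ a₅ : Subset n) → ℕ
sizeSum a₁ a₂ a₃ a₄ a₅ = ∣ a₁ ∣ + ∣ a₂ ∣ + ∣ a₃ ∣ + ∣ a₄ ∣ + ∣ a₅ ∣

overlapSum : ∀ {n} (a₁ a₂ a₃ a₄ a₅ : Subset n) → ℕ
overlapSum a₁ a₂ a₃ a₄ a₅ = sizeSum (a₁ ∩ a₂) (a₂ ∩ a₃) (a₃ ∩ a₄) (a₄ ∩ a₅) (a₅ ∩ a₁)

∣x∷p∣≡∣x∷[]∣+∣p∣ : ∀ {n} x (p : Subset n) → ∣ x ∷ p ∣ ≡ ∣ x ∷ [] ∣ + ∣ p ∣
∣x∷p∣≡∣x∷[]∣+∣p∣ true  p = refl
∣x∷p∣≡∣x∷[]∣+∣p∣ false p = refl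

sizeSum-∷ : ∀ {n} x₁ x₂ x₃ x₄ x₅ (a₁ a₂ a₃ a₄ a₅ : Subset n) →
  sizeSum (x₁ ∷ a₁) (x₂ ∷ a₂) (x₃ ∷ a₃) (x₄ ∷ a₄) (x₅ ∷ a₅) ≡
  sizeSum (x₁ ∷ []) (x₂ ∷ []) (x₃ ∷ []) (x₄ ∷ []) (x₅ ∷ []) + sizeSum a₁ a₂ a₃ a₄ a₅
sizeSum-∷ x₁ x₂ x₃ x₄ x₅ a₁ a₂ a₃ a₄ a₅
  rewrite ∣x∷p∣≡∣x∷[]∣+∣p∣ x₁ a₁ | ∣x∷p∣≡∣x∷[]∣+∣p∣ x₂ a₂ | ∣x∷p∣≡∣x∷[]∣+∣p∣ x₃ a₃
        | ∣x∷p∣≡∣x∷[]∣+∣p∣ x₄ a₄ | ∣x∷p∣≡∣x∷[]∣+∣p∣ x₅ a₅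
  = interchange (∣ x₁ ∷ [] ∣) (∣ x₂ ∷ [] ∣) (∣ x₃ ∷ [] ∣) (∣ x₄ ∷ [] ∣) (∣ x₅ ∷ [] ∣)
                (∣ a₁ ∣) (∣ a₂ ∣) (∣ a₃ ∣) (∣ a₄ ∣) (∣ a₅ ∣)
  where
  interchange : ∀ y₁ y₂ y₃ y₄ y₅ z₁ z₂ z₃ z₄ z₅ →
    (y₁ + z₁) + (y₂ + z₂) + (y₃ + z₃) + (y₄ + z₄) + (y₅ + z₅) ≡
    (y₁ + y₂ + y₃ + y₄ + y₅) + (z₁ + z₂ + z₃ + z₄ + z₅)
  interchange = solve-∀

∀-Bool? : {P : Bool → Set} → (∀ b → Dec (P b)) → Dec (∀ b → P b)
∀-Bool? P? = map′ (λ { (p , q) true → p ; (p , q) false → q }) (λ f → f true , f false) (P? true ×-dec P? false)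

-- A cyclic 0/1 word of odd length 5 has at most two maximal blocks of 1s.
sizeSum≤2+overlapSum : ∀ x₁ x₂ x₃ x₄ x₅ →
  sizeSum (x₁ ∷ []) (x₂ ∷ []) (x₃ ∷ []) (x₄ ∷ []) (x₅ ∷ []) ≤
  2 + overlapSum (x₁ ∷ []) (x₂ ∷ []) (x₃ ∷ []) (x₄ ∷ []) (x₅ ∷ [])
sizeSum≤2+overlapSum =
  toWitness {a? = ∀-Bool? λ _ → ∀-Bool? λ _ → ∀-Bool? λ _ → ∀-Bool? λ _ → ∀-Bool? λ _ → _ ≤? _} _

sizeSum≤2n+overlapSum : ∀ {n} (a₁ a₂ a₃ a₄ a₅ : Subset n) →
  sizeSum a₁ a₂ a₃ a₄ a₅ ≤ 2 * n + overlapSum a₁ a₂ a₃ a₄ a₅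
sizeSum≤2n+overlapSum [] [] [] [] [] = z≤n
sizeSum≤2n+overlapSum {suc n} (x₁ ∷ a₁) (x₂ ∷ a₂) (x₃ ∷ a₃) (x₄ ∷ a₄) (x₅ ∷ a₅) = begin
  sizeSum (x₁ ∷ a₁) (x₂ ∷ a₂) (x₃ ∷ a₃) (x₄ ∷ a₄) (x₅ ∷ a₅)
    ≡⟨ sizeSum-∷ x₁ x₂ x₃ x₄ x₅ a₁ a₂ a₃ a₄ a₅ ⟩
  sizeSum [x₁] [x₂] [x₃] [x₄] [x₅] + sizeSum a₁ a₂ a₃ a₄ a₅
    ≤⟨ +-mono-≤ (sizeSum≤2+overlapSum x₁ x₂ x₃ x₄ x₅) (sizeSum≤2n+overlapSum a₁ a₂ a₃ a₄ a₅) ⟩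
  (2 + overlapSum [x₁] [x₂] [x₃] [x₄] [x₅]) + (2 * n + overlapSum a₁ a₂ a₃ a₄ a₅)
    ≡⟨ regroup n (overlapSum [x₁] [x₂] [x₃] [x₄] [x₅]) (overlapSum a₁ a₂ a₃ a₄ a₅) ⟩
  2 * suc n + (overlapSum [x₁] [x₂] [x₃] [x₄] [x₅] + overlapSum a₁ a₂ a₃ a₄ a₅)
    ≡⟨ cong (2 * suc n +_) (sym (sizeSum-∷ (x₁ ∧ x₂) (x₂ ∧ x₃) (x₃ ∧ x₄) (x₄ ∧ x₅) (x₅ ∧ x₁)
                                            (a₁ ∩ a₂) (a₂ ∩ a₃) (a₃ ∩ a₄) (a₄ ∩ a₅) (a₅ ∩ a₁))) ⟩
  2 * suc n + overlapSum (x₁ ∷ a₁) (x₂ ∷ a₂) (x₃ ∷ a₃) (x₄ ∷ a₄) (x₅ ∷ a₅) ∎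
  where
  open ≤-Reasoning
  [x₁] [x₂] [x₃] [x₄] [x₅] : Subset 1
  [x₁] = x₁ ∷ []
  [x₂] = x₂ ∷ []
  [x₃] = x₃ ∷ []
  [x₄] = x₄ ∷ []
  [x₅] = x₅ ∷ []
  regroup : ∀ n y z → (2 + y) + (2 * n + z) ≡ 2 * suc n + (y + z)
  regroup = solve-∀

2n<5[k∸t]⇒2n+5t<5k : ∀ {n k t} → 2 * n < 5 * (k ∸ t) → 2 * n + (t + t + t + t + t) < k + k + k + k + k
2n<5[k∸t]⇒2n+5t<5k {n} {k} {t} 2n<5[k∸t] with ≤-total t k
... | inj₂ k≤t = ⊥-elim (n≮0 (subst (λ d → 2 * n < 5 * d) (m≤n⇒m∸n≡0 k≤t) 2n<5[k∸t]))
... | inj₁ t≤k = begin-strict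
  2 * n + (t + t + t + t + t)               <⟨ +-monoˡ-< (t + t + t + t + t) 2n<5[k∸t] ⟩
  5 * (k ∸ t) + (t + t + t + t + t)         ≡⟨ fivefold (k ∸ t) t ⟩
  (k ∸ t + t) + (k ∸ t + t) + (k ∸ t + t) + (k ∸ t + t) + (k ∸ t + t)
                                            ≡⟨ cong (λ m → m + m + m + m + m) (m∸n+n≡m t≤k) ⟩
  k + k + k + k + k                         ∎
  where
  open ≤-Reasoning
  fivefold : ∀ d t → 5 * d + (t + t + t + t + t) ≡ (d + t) + (d + t) + (d + t) + (d + t) + (d + t)
  fivefold = solve-∀

Searchable : Set → Set₁
Searchable A = {P : A → Set} → (∀ a → Dec (P a)) → Dec (∃ P)

searchable-Σ : {A : Set} {B : A → Set} → Searchable A → (∀ a → Searchable (B a)) → Searchable (Σ A B)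
searchable-Σ searchA searchB P? =
  map′ (λ (a , b , p) → (a , b) , p) (λ ((a , b) , p) → a , b , p) (searchA λ a → searchB a λ b → P? (a , b))

searchable-irrelevant : {A : Set} → Irrelevant A → Dec A → Searchable A
searchable-irrelevant irr (yes a) {P} P? = map′ (a ,_) (λ (a′ , p) → subst P (irr a′ a) p) (P? a)
searchable-irrelevant irr (no ¬a) P?     = no (¬a ∘ proj₁)

_≁[_]_ : {V : Set} → V → Rel V 0ℓ → V → Set
u ≁[ Adj ] v = u ≢ v × ¬ Adj u v

-- Closed walks, not only cycles: a triangle u v w yields the closed walk u v w u v u.
NoComplementClosed5Walk : {V : Set} → Rel V 0ℓ → Set
NoComplementClosed5Walk Adj = ∀ {v₁ v₂ v₃ v₄ v₅} →
  v₁ ≁[ Adj ] v₂ → v₂ ≁[ Adj ] v₃ → v₃ ≁[ Adj ] v₄ → v₄ ≁[ Adj ] v₅ → v₅ ≁[ Adj ] v₁ → ⊥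

CommonNonNeighbour : {V : Set} → Rel V 0ℓ → V → V → Set
CommonNonNeighbour Adj a b = ∃[ v ] (v ≁[ Adj ] a × v ≁[ Adj ] b)

DominatingEdge : {V : Set} → Rel V 0ℓ → V → V → Set
DominatingEdge Adj a b = Adj a b × (∀ v → v ≢ a → v ≢ b → Adj v a ⊎ Adj v b)

module _ {V : Set} {Adj : Rel V 0ℓ} where

  nonadjacent-pair : ∀ {m} → 2 ≤ m → IndependenceNumber Adj m → ∃₂ _≁[ Adj ]_
  nonadjacent-pair (s≤s (s≤s _)) (((x ∷ y ∷ _) , ((x≢y ∷ _) ∷ _ , independent) , refl) , _) =
    x , y , x≢y , independent (here refl) (there (here refl))

  dominatingEdge⇒matching : Irreflexive _≡_ Adj → ∀ {a b} → DominatingEdge Adj a b →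
    HasNonemptyConnectedDominatingMatching Adj
  dominatingEdge⇒matching irrefl {a} {b} (a~b , dominates) =
    (a , b) ∷ [] , (λ ()) , (matching , touches) , (matching , dominated)
    where
    matching : IsMatching Adj ((a , b) ∷ [])
    matching = (a~b ∷ []) , ((λ a≡b → irrefl a≡b a~b) ∷ []) ∷ [] ∷ []
    touches : ∀ {e f} → e ∈ (a , b) ∷ [] → f ∈ (a , b) ∷ [] → EdgesTouch Adj e f
    touches (here refl) (here refl) = inj₁ (inj₂ a~b)
    dominated : ∀ v → ¬ v ∈ a ∷ b ∷ [] → ∀ {e} → e ∈ (a , b) ∷ [] → Adj v (proj₁ e) ⊎ Adj v (proj₂ e)
    dominated v v∉ (here refl) = dominates v (v∉ ∘ here) (v∉ ∘ there ∘ here)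

module _ {V : Set} {Adj : Rel V 0ℓ}
         (_≟V_ : DecidableEquality V) (adj? : Decidable Adj) (adj-sym : Symmetric Adj)
         (no-closed-5-walk : NoComplementClosed5Walk Adj) where

  private
    _≁_ : Rel V 0ℓ
    u ≁ v = u ≁[ Adj ] v

  _≁?_ : Decidable _≁_
  u ≁? v = ¬? (u ≟V v) ×-dec ¬? (adj? u v)

  ≁-sym : Symmetric _≁_
  ≁-sym (u≢v , ¬u~v) = u≢v ∘ sym , ¬u~v ∘ adj-sym

  ¬≁⇒adjacent : ∀ {u v} → u ≢ v → ¬ u ≁ v → Adj u v
  ¬≁⇒adjacent u≢v ¬u≁v = decidable-stable (adj? _ _) (λ ¬adj → ¬u≁v (u≢v , ¬adj))

  no-complement-triangle : ∀ {u v w} → u ≁ v → v ≁ w → w ≁ u → ⊥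
  no-complement-triangle u≁v v≁w w≁u = no-closed-5-walk u≁v v≁w w≁u u≁v (≁-sym u≁v)

  ¬commonNonNeighbour⇒dominating : ∀ {a b} → Adj a b → ¬ CommonNonNeighbour Adj a b → DominatingEdge Adj a b
  ¬commonNonNeighbour⇒dominating {a} {b} a~b ¬common = a~b , dominates
    where
    dominates : ∀ v → v ≢ a → v ≢ b → Adj v a ⊎ Adj v b
    dominates v v≢a v≢b with v ≁? a | v ≁? b
    ... | no ¬v≁a | _         = inj₁ (¬≁⇒adjacent v≢a ¬v≁a)
    ... | yes _   | no ¬v≁b   = inj₂ (¬≁⇒adjacent v≢b ¬v≁b)
    ... | yes v≁a | yes v≁b   = ⊥-elim (¬common (v , v≁a , v≁b))

  module _ (common : ∀ {a b} → Adj a b → CommonNonNeighbour Adj a b) {x y} (x≁y : x ≁ y) where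

    ≁x⊎≁y : ∀ v → v ≁ x ⊎ v ≁ y
    ≁x⊎≁y v with v ≁? x | v ≁? y
    ... | yes v≁x | _       = inj₁ v≁x
    ... | no _    | yes v≁y = inj₂ v≁y
    ... | no ¬v≁x | no ¬v≁y
      with common (¬≁⇒adjacent (λ { refl → ¬v≁y x≁y }) ¬v≁x)
         | common (¬≁⇒adjacent (λ { refl → ¬v≁x (≁-sym x≁y) }) ¬v≁y)
    ... | u , u≁v , u≁x | w , w≁v , w≁y = ⊥-elim (no-closed-5-walk (≁-sym u≁v) u≁x x≁y (≁-sym w≁y) w≁v)

    ≁y-step : ∀ {a b} → Adj a b → a ≁ y → b ≁ y
    ≁y-step {a} {b} a~b a≁y with ≁x⊎≁y b
    ... | inj₂ b≁y = b≁y
    ... | inj₁ b≁x with common a~b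
    ...   | u , u≁a , u≁b with ≁x⊎≁y u
    ...     | inj₁ u≁x = ⊥-elim (no-complement-triangle u≁b b≁x (≁-sym u≁x))
    ...     | inj₂ u≁y = ⊥-elim (no-complement-triangle u≁a a≁y (≁-sym u≁y))

    ≁y-along-walk : ∀ {a b} → Star Adj a b → a ≁ y → b ≁ y
    ≁y-along-walk ε         a≁y = a≁y
    ≁y-along-walk (a~c ◅ w) a≁y = ≁y-along-walk w (≁y-step a~c a≁y)

  nonadjacent⇒disconnected : (∀ {a b} → Adj a b → CommonNonNeighbour Adj a b) →
    ∀ {x y} → x ≁ y → ¬ Star Adj x y
  nonadjacent⇒disconnected common x≁y walk = proj₁ (≁y-along-walk common x≁y walk x≁y) refl

  commonNonNeighbour? : Searchable V → ∀ a b → Dec (CommonNonNeighbour Adj a b)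
  commonNonNeighbour? search a b = search λ v → v ≁? a ×-dec v ≁? b

  dominating-edge : Searchable V → Connected Adj → ∃₂ _≁_ → ∃₂ (DominatingEdge Adj)
  dominating-edge search connected (x , y , x≁y)
    with search (λ a → search (λ b → adj? a b ×-dec ¬? (commonNonNeighbour? search a b)))
  ... | yes (a , b , a~b , ¬common) = a , b , ¬commonNonNeighbour⇒dominating a~b ¬common
  ... | no ∄edge = ⊥-elim (nonadjacent⇒disconnected common x≁y (connected x y))
    where
    common : ∀ {a b} → Adj a b → CommonNonNeighbour Adj a b
    common {a} {b} a~b =
      decidable-stable (commonNonNeighbour? search a b) λ ¬common → ∄edge (a , b , a~b , ¬common)

module _ {VH : Set} (AdjH : Rel VH 0ℓ) (c : VH → ℕ) where

  inflation-irreflexive : Irreflexive _≡_ (InflAdj AdjH c)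
  inflation-irreflexive refl (p≢p , _) = p≢p refl

  inflation-sym : Symmetric AdjH → Symmetric (InflAdj AdjH c)
  inflation-sym _      (p≢q , inj₁ x≡y) = p≢q ∘ sym , inj₁ (sym x≡y)
  inflation-sym adj-sym (p≢q , inj₂ x~y) = p≢q ∘ sym , inj₂ (adj-sym x~y)

  inflation-≟ : DecidableEquality VH → DecidableEquality (InflVertex AdjH c)
  inflation-≟ _≟H_ = Σ.≡-dec _≟H_ Fin._≟_

  inflation-adj? : DecidableEquality VH → Decidable AdjH → Decidable (InflAdj AdjH c)
  inflation-adj? _≟H_ adj? p q =
    ¬? (inflation-≟ _≟H_ p q) ×-dec (proj₁ p ≟H proj₁ q ⊎-dec adj? (proj₁ p) (proj₁ q))

  inflation-searchable : Searchable VH → Searchable (InflVertex AdjH c)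
  inflation-searchable search = searchable-Σ search (λ _ → Fin.any?)

  ≁-inflation : ∀ {p q} → p ≁[ InflAdj AdjH c ] q → proj₁ p ≁[ AdjH ] proj₁ q
  ≁-inflation (p≢q , ¬p~q) = (λ x≡y → ¬p~q (p≢q , inj₁ x≡y)) , (λ x~y → ¬p~q (p≢q , inj₂ x~y))

  inflation-no-closed-5-walk : NoComplementClosed5Walk AdjH → NoComplementClosed5Walk (InflAdj AdjH c)
  inflation-no-closed-5-walk no-walk p₁≁p₂ p₂≁p₃ p₃≁p₄ p₄≁p₅ p₅≁p₁ =
    no-walk (≁-inflation p₁≁p₂) (≁-inflation p₂≁p₃) (≁-inflation p₃≁p₄) (≁-inflation p₄≁p₅) (≁-inflation p₅≁p₁)

module _ {n k : ℕ} where

  KVertex-≡ : {A B : KVertex n k} → proj₁ A ≡ proj₁ B → A ≡ B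
  KVertex-≡ {a , _} {.a , _} refl = cong (a ,_) (≡-irrelevant _ _)

  KVertex-≟ : DecidableEquality (KVertex n k)
  KVertex-≟ = Σ.≡-dec (Vec.≡-dec Bool._≟_) (λ p q → yes (≡-irrelevant p q))

  KVertex-searchable : Searchable (KVertex n k)
  KVertex-searchable = searchable-Σ anySubset? (λ a → searchable-irrelevant ≡-irrelevant (∣ a ∣ ≟ k))

  KAdj-sym : ∀ {s} → Symmetric (KAdj n k s)
  KAdj-sym {s} {a , _} {b , _} (a≢b , s≤∣a∩b∣) = a≢b ∘ sym , subst (s ≤_) (cong ∣_∣ (∩-comm a b)) s≤∣a∩b∣

  KAdj? : ∀ {s} → Decidable (KAdj n k s)
  KAdj? {s} (a , _) (b , _) = ¬? (Vec.≡-dec Bool._≟_ a b) ×-dec (s ≤? ∣ a ∩ b ∣)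

  ≁⇒∣∩∣≤ : ∀ {t A B} → A ≁[ KAdj n k (suc t) ] B → ∣ proj₁ A ∩ proj₁ B ∣ ≤ t
  ≁⇒∣∩∣≤ (A≢B , ¬A~B) = ≮⇒≥ λ t<∣a∩b∣ → ¬A~B (A≢B ∘ KVertex-≡ , t<∣a∩b∣)

  K-no-closed-5-walk : ∀ {t} → 2 * n < 5 * (k ∸ t) → NoComplementClosed5Walk (KAdj n k (suc t))
  K-no-closed-5-walk {t} gap {a₁ , ∣a₁∣≡k} {a₂ , ∣a₂∣≡k} {a₃ , ∣a₃∣≡k} {a₄ , ∣a₄∣≡k} {a₅ , ∣a₅∣≡k}
                     A₁≁A₂ A₂≁A₃ A₃≁A₄ A₄≁A₅ A₅≁A₁ =
    <⇒≱ (2n<5[k∸t]⇒2n+5t<5k {n} {k} {t} gap) (begin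
      k + k + k + k + k             ≡⟨ sym sizes ⟩
      sizeSum a₁ a₂ a₃ a₄ a₅        ≤⟨ sizeSum≤2n+overlapSum a₁ a₂ a₃ a₄ a₅ ⟩
      2 * n + overlapSum a₁ a₂ a₃ a₄ a₅  ≤⟨ +-monoʳ-≤ (2 * n) overlaps ⟩
      2 * n + (t + t + t + t + t)   ∎)
    where
    open ≤-Reasoning
    sizes : sizeSum a₁ a₂ a₃ a₄ a₅ ≡ k + k + k + k + k
    sizes = cong₂ _+_ (cong₂ _+_ (cong₂ _+_ (cong₂ _+_ ∣a₁∣≡k ∣a₂∣≡k) ∣a₃∣≡k) ∣a₄∣≡k) ∣a₅∣≡k
    overlaps : overlapSum a₁ a₂ a₃ a₄ a₅ ≤ t + t + t + t + t
    overlaps = +-mono-≤ (+-mono-≤ (+-mono-≤ (+-mono-≤ (≁⇒∣∩∣≤ A₁≁A₂) (≁⇒∣∩∣≤ A₂≁A₃))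
                                  (≁⇒∣∩∣≤ A₃≁A₄)) (≁⇒∣∩∣≤ A₄≁A₅)) (≁⇒∣∩∣≤ A₅≁A₁)

theorem3p12 : (n k t : ℕ) → 1 ≤ n → 1 ≤ k → 1 ≤ t →
    2 * k ≤ n + t → 2 * n < 5 * (k ∸ t) →
    (c : KVertex n k → ℕ) →
    Connected (InflAdj (KAdj n k (suc t)) c) →
    IndependenceNumber (InflAdj (KAdj n k (suc t)) c) 2 →
    HasNonemptyConnectedDominatingMatching (InflAdj (KAdj n k (suc t)) c)
theorem3p12 n k t _ _ _ _ 2n<5[k∸t] c connected α≡2 =
  let (_ , _ , ab-dominates) =
        dominating-edge (inflation-≟ H c KVertex-≟) (inflation-adj? H c KVertex-≟ KAdj?)
                        -- A and B must be bound by hand: their cardinality proofs do not occur in H A B.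
                        (inflation-sym H c λ {A B} → KAdj-sym {x = A} {y = B})
                        (inflation-no-closed-5-walk H c (K-no-closed-5-walk 2n<5[k∸t]))
                        (inflation-searchable H c KVertex-searchable)
                        connected (nonadjacent-pair (s≤s (s≤s z≤n)) α≡2)
  in dominatingEdge⇒matching (inflation-irreflexive H c) ab-dominates
  where
  H : Rel (KVertex n k) 0ℓ
  H = KAdj n k (suc t)
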